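{- Fix any logic $\mathcal{L}$, a signature $\Sigma$, sets $X, Y$, an interpretation $H$ of $\Sigma$ over $Y$ and a function $f : X \to Y$, and put $\varphi = f^\dagger_H : [\![\Sigma]\!]X \to Y$. Then for every well-typed template $\Gamma; Z \vdash T : \Sigma$ with $Z = (z_j : B_j \to *)_j$, every $\eta \in [\![\Gamma]\!]$ and every $\zeta = (\zeta_j)_j \in [\![Z]\!]([\![\Sigma]\!]X)$, $$\varphi\big([\![T]\!]_{F^X_\Sigma}(\eta;\zeta)\big) = [\![T]\!]_H\big(\eta; (\varphi\circ \zeta_j)_j\big).$$ Moreover, every function $\varphi : [\![\Sigma]\!]X \to Y$ satisfying this equation for all such well-typed templates $T$, all $\eta$ and all $\zeta$ is of the form $f^\dagger_H$ for some $f : X \to Y$.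
   Context: Calculus. Values $v ::= x \mid () \mid \mathtt{true} \mid \mathtt{false} \mid \mathtt{fun}\,x\mapsto c \mid \mathtt{handler}\,\{\mathtt{return}\,x \mapsto c_r;\ h\}$; computations $c ::= \mathtt{if}\ v\ \mathtt{then}\ c_1\ \mathtt{else}\ c_2 \mid v_1\,v_2 \mid \mathtt{return}\ v \mid \mathit{op}(v; y.c) \mid \mathtt{do}\ x \leftarrow c_1\ \mathtt{in}\ c_2 \mid \mathtt{with}\ v\ \mathtt{handle}\ c$; operation clauses $h$ are finite sets of clauses $\mathit{op}(x;k)\mapsto c_{\mathit{op}}$. Value types $A,B ::= \mathtt{unit}\mid \mathtt{bool} \mid A \to \underline{C} \mid \underline{C}\Rightarrow \underline{D}$; computation types $\underline{C} ::= A\,!\,\Sigma/\mathcal{E}$, with $\Sigma$ a finite set of declarations $\mathit{op}: A_{\mathit{op}} \to B_{\mathit{op}}$ (distinct symbols) and $\mathcal{E}$ a finite set of equations between templates $T ::= z\,v \mid \mathtt{if}\ v\ \mathtt{then}\ T_1\ \mathtt{else}\ T_2 \mid \mathit{op}(v; y.T)$. Terms are typed by the usual rules of this fine-grain call-by-value calculus with effect-annotated computation types (handler values additionally require a well-definedness judgment supplied by the fixed logic $\mathcal L$). Templates are typed by: $\Gamma;Z\vdash z\,v:\Sigma$ if $(z:A\to*)\in Z$ and $\Gamma\vdash v:A$; $\Gamma;Z\vdash\mathtt{if}\ v\ \mathtt{then}\ T_1\ \mathtt{else}\ T_2:\Sigma$ if $\Gamma\vdash v:\mathtt{bool}$ and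 both $T_i$ are well-typed; $\Gamma;Z\vdash\mathit{op}(v;y.T):\Sigma$ if $(\mathit{op}:A\to B)\in\Sigma$, $\Gamma\vdash v:A$, $\Gamma,y:B;Z\vdash T:\Sigma$. Semantics. $[\![\mathtt{unit}]\!]=\{\star\}$, $[\![\mathtt{bool}]\!]=\{\mathrm{ff},\mathrm{tt}\}$, $[\![A\to\underline C]\!]=[\![A]\!]\to[\![\underline C]\!]$, $[\![\underline C\Rightarrow\underline D]\!]=[\![\underline C]\!]\to[\![\underline D]\!]$, $[\![A\,!\,\Sigma/\mathcal E]\!]=[\![\Sigma]\!][\![A]\!]$, where $[\![\Sigma]\!]X$ is the inductive set generated by $\mathrm{in}_{\mathrm{ret}}(a)$ ($a\in X$) and $\mathrm{in}_{op}(a;\kappa)$ ($\mathit{op}\in\Sigma$, $a\in[\![A_{op}]\!]$, $\kappa:[\![B_{op}]\!]\to[\![\Sigma]\!]X$). $[\![\Gamma]\!]$ is the product of its types' denotations, and a well-typed value $\Gamma\vdash v:A$ has a denotation $[\![v]\!]:[\![\Gamma]\!]\to[\![A]\!]$ (standard set-theoretic semantics, e.g. $[\![\mathtt{true}]\!]\eta=\mathrm{tt}$, variables are projections). An interpretation $H$ of $\Sigma$ over $Y$ is a family $H_{op}:[\![A_{op}]\!]\times([\![B_{op}]\!]\to Y)\to Y$ for $(\mathit{op}:A_{op}\to B_{op})\in\Sigma$. The free interpretation $F^X_\Sigma$ over $[\![\Sigma]\!]X$ is $(F^X_\Sigma)_{op}(a,\kappa)=\mathrm{in}_{op}(a;\kappa)$.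 The lift $f^\dagger_H:[\![\Sigma]\!]X\to Y$ of $f:X\to Y$ is defined by $f^\dagger_H(\mathrm{in}_{\mathrm{ret}}(x))=f(x)$, $f^\dagger_H(\mathrm{in}_{op}(a;\kappa))=H_{op}(a,f^\dagger_H\circ\kappa)$. For $Z=(z_j:B_j\to*)_j$, $[\![Z]\!]Y=\prod_j Y^{[\![B_j]\!]}$. For an interpretation $H$ over $Y$ and a well-typed template $\Gamma;Z\vdash T:\Sigma$, $[\![T]\!]_H:[\![\Gamma]\!]\times[\![Z]\!]Y\to Y$ is defined by $[\![z_i\,v]\!]_H(\eta;\zeta)=\zeta_i([\![v]\!]\eta)$; $[\![\mathtt{if}\ v\ \mathtt{then}\ T_1\ \mathtt{else}\ T_2]\!]_H(\eta;\zeta)=[\![T_1]\!]_H(\eta;\zeta)$ if $[\![v]\!]\eta=\mathrm{tt}$ and $[\![T_2]\!]_H(\eta;\zeta)$ if $=\mathrm{ff}$; $[\![\mathit{op}(v;y.T)]\!]_H(\eta;\zeta)=H_{op}([\![v]\!]\eta,\lambda b.[\![T]\!]_H((\eta,b);\zeta))$. -}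

module Defs where

open import Data.Nat using (ℕ; zero; suc)
open import Data.Fin using (Fin; zero; suc)
open import Data.Bool using (Bool; true; false; if_then_else_)
open import Data.Unit using (⊤; tt)
open import Data.Product using (_×_; _,_; proj₁; proj₂)
open import Data.List using (List; []; _∷_; length; map)
open import Data.List.Membership.Propositional using (_∈_)

-- Raw syntax (de Bruijn indices; the most recently bound variable is 0)

mutual
  data VTy : Set where
    unit : VTy
    bool : VTy
    _⟶_  : VTy → CTy → VTy
    _⇛_  : CTy → CTy → VTy

  data CTy : Set where
    _!_/_ : VTy → List Decl → List Eqn → CTy

  data Decl : Set where
    decl : ℕ → VTy → VTy → Decl

  -- an equation  Γ ; Z ⊢ T₁ = T₂  between templates
  data Eqn : Set where
    eqn : List VTy → List VTy → Tmpl → Tmpl → Eqn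

  data Tmpl : Set where
    tvar : ℕ → Val → Tmpl
    tif  : Val → Tmpl → Tmpl → Tmpl
    top  : ℕ → Val → Tmpl → Tmpl        -- top op v T  binds y in T

  data Val : Set where
    var     : ℕ → Val
    vunit   : Val
    vtrue   : Val
    vfalse  : Val
    fun     : Comp → Val                  -- fun x ↦ c  (binds x)
    handler : Comp → List (ℕ × Comp) → Val
    -- handler {return x ↦ c_r ; h}; a clause (op , c) is op(x;k) ↦ c,
    -- binding x (index 1) and k (index 0) in c

  data Comp : Set where
    cif    : Val → Comp → Comp → Comp
    app    : Val → Val → Comp
    return : Val → Comp
    cop    : ℕ → Val → Comp → Comp        -- op(v; y.c)
    cdo    : Comp → Comp → Comp           -- do x ← c₁ in c₂
    with-handle : Val → Comp → Comp

Sig : Set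
Sig = List Decl

Ctx : Set
Ctx = List VTy

-- template-variable context Z = (z_j : B_j → *)_j, recorded by the B_j
TCtx : Set
TCtx = List VTy

declName : Decl → ℕ
declName (decl n _ _) = n

data Free (O : Set) (P R : O → Set) (X : Set) : Set where
  in-ret : X → Free O P R X
  in-op  : (o : O) → P o → (R o → Free O P R X) → Free O P R X

-- operations of a signature are its positions
Op : Sig → Set
Op Σ = Fin (length Σ)

mutual
  ⟦_⟧v : VTy → Set
  ⟦ unit ⟧v  = ⊤
  ⟦ bool ⟧v  = Bool
  ⟦ A ⟶ C ⟧v = ⟦ A ⟧v → ⟦ C ⟧c
  ⟦ C ⇛ D ⟧v = ⟦ C ⟧c → ⟦ D ⟧c

  ⟦_⟧c : CTy → Set
  ⟦ A ! Σ / E ⟧c = Free (Op Σ) (SArg Σ) (SRes Σ) ⟦ A ⟧v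

  SArg : (Σ : Sig) → Op Σ → Set
  SArg (_ ∷ Σ)          (suc i) = SArg Σ i
  SArg (decl _ A _ ∷ Σ) zero    = ⟦ A ⟧v

  SRes : (Σ : Sig) → Op Σ → Set
  SRes (_ ∷ Σ)          (suc i) = SRes Σ i
  SRes (decl _ _ B ∷ Σ) zero    = ⟦ B ⟧v

⟦_⟧Σ : Sig → Set → Set
⟦ Σ ⟧Σ X = Free (Op Σ) (SArg Σ) (SRes Σ) X

⟦_⟧ctx : Ctx → Set
⟦ [] ⟧ctx    = ⊤
⟦ A ∷ Γ ⟧ctx = ⟦ Γ ⟧ctx × ⟦ A ⟧v

⟦_⟧Z : TCtx → Set → Set
⟦ [] ⟧Z Y    = ⊤
⟦ B ∷ Z ⟧Z Y = ⟦ Z ⟧Z Y × (⟦ B ⟧v → Y)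

mapZ : ∀ {Y Y′ : Set} (Z : TCtx) → (Y → Y′) → ⟦ Z ⟧Z Y → ⟦ Z ⟧Z Y′
mapZ []      φ tt      = tt
mapZ (B ∷ Z) φ (ζ , g) = mapZ Z φ ζ , (λ b → φ (g b))

-- an interpretation H of Σ over Y
-- (a family H_op : ⟦A_op⟧ × (⟦B_op⟧ → Y) → Y, curried, indexed by the
-- positions of Σ; wrapped in a record only to help type inference)
record Interp (Σ : Sig) (Y : Set) : Set where
  constructor interp
  field
    apply : (o : Op Σ) → SArg Σ o → (SRes Σ o → Y) → Y
open Interp public

freeInterp : (Σ : Sig) (X : Set) → Interp Σ (⟦ Σ ⟧Σ X)
freeInterp Σ X = interp (λ o a κ → in-op o a κ)

lift : ∀ {Σ : Sig} {X Y : Set} → (X → Y) → Interp Σ Y → ⟦ Σ ⟧Σ X → Y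
lift f H (in-ret x)     = f x
lift f H (in-op o a κ)  = apply H o a (λ b → lift f H (κ b))

data _∋_⦂_ : List VTy → ℕ → VTy → Set where
  here  : ∀ {Γ A} → (A ∷ Γ) ∋ zero ⦂ A
  there : ∀ {Γ A B i} → Γ ∋ i ⦂ A → (B ∷ Γ) ∋ suc i ⦂ A

data _∋op_⦂_⟶_ : Sig → ℕ → VTy → VTy → Set where
  here  : ∀ {Σ n A B} → (decl n A B ∷ Σ) ∋op n ⦂ A ⟶ B
  there : ∀ {Σ d n A B} → Σ ∋op n ⦂ A ⟶ B → (d ∷ Σ) ∋op n ⦂ A ⟶ B

-- the fixed logic 𝓛, which supplies the well-definedness judgment for
-- handlers:  wd Γ v C D  reads "Γ ⊢ v is a well-defined handler C ⇒ D"
record Logic : Set₁ where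
  field
    wd : Ctx → Val → CTy → CTy → Set

module Typing (L : Logic) where
  open Logic L

  mutual
    data _⊢v_⦂_ (Γ : Ctx) : Val → VTy → Set where
      ty-var   : ∀ {i A} → Γ ∋ i ⦂ A → Γ ⊢v var i ⦂ A
      ty-unit  : Γ ⊢v vunit ⦂ unit
      ty-true  : Γ ⊢v vtrue ⦂ bool
      ty-false : Γ ⊢v vfalse ⦂ bool
      ty-fun   : ∀ {A C c} → (A ∷ Γ) ⊢c c ⦂ C → Γ ⊢v fun c ⦂ (A ⟶ C)
      ty-handler : ∀ {A Σ E D cr h} →
        (A ∷ Γ) ⊢c cr ⦂ D →
        Clauses Γ h Σ D →
        wd Γ (handler cr h) (A ! Σ / E) D →
        Γ ⊢v handler cr h ⦂ ((A ! Σ / E) ⇛ D)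

    data Clauses (Γ : Ctx) (h : List (ℕ × Comp)) : Sig → CTy → Set where
      cl-[] : ∀ {D} → Clauses Γ h [] D
      cl-∷  : ∀ {n A B Σ D c} →
        (n , c) ∈ h →
        ((B ⟶ D) ∷ A ∷ Γ) ⊢c c ⦂ D →
        Clauses Γ h Σ D →
        Clauses Γ h (decl n A B ∷ Σ) D

    data _⊢c_⦂_ (Γ : Ctx) : Comp → CTy → Set where
      ty-if  : ∀ {v c₁ c₂ C} → Γ ⊢v v ⦂ bool → Γ ⊢c c₁ ⦂ C → Γ ⊢c c₂ ⦂ C →
               Γ ⊢c cif v c₁ c₂ ⦂ C
      ty-app : ∀ {v₁ v₂ A C} → Γ ⊢v v₁ ⦂ (A ⟶ C) → Γ ⊢v v₂ ⦂ A →
               Γ ⊢c app v₁ v₂ ⦂ C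
      ty-return : ∀ {v A Σ E} → Γ ⊢v v ⦂ A → Γ ⊢c return v ⦂ (A ! Σ / E)
      ty-op  : ∀ {n v c A Aop Bop Σ E} → Σ ∋op n ⦂ Aop ⟶ Bop →
               Γ ⊢v v ⦂ Aop → (Bop ∷ Γ) ⊢c c ⦂ (A ! Σ / E) →
               Γ ⊢c cop n v c ⦂ (A ! Σ / E)
      ty-do  : ∀ {c₁ c₂ A B Σ E} → Γ ⊢c c₁ ⦂ (A ! Σ / E) →
               (A ∷ Γ) ⊢c c₂ ⦂ (B ! Σ / E) → Γ ⊢c cdo c₁ c₂ ⦂ (B ! Σ / E)
      ty-with : ∀ {v c C D} → Γ ⊢v v ⦂ (C ⇛ D) → Γ ⊢c c ⦂ C →
                Γ ⊢c with-handle v c ⦂ D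

  data _⨾_⊢t_⦂_ (Γ : Ctx) (Z : TCtx) : Tmpl → Sig → Set where
    ty-tvar : ∀ {i v B Σ} → Z ∋ i ⦂ B → Γ ⊢v v ⦂ B → Γ ⨾ Z ⊢t tvar i v ⦂ Σ
    ty-tif  : ∀ {v T₁ T₂ Σ} → Γ ⊢v v ⦂ bool → Γ ⨾ Z ⊢t T₁ ⦂ Σ →
              Γ ⨾ Z ⊢t T₂ ⦂ Σ → Γ ⨾ Z ⊢t tif v T₁ T₂ ⦂ Σ
    ty-top  : ∀ {n v T A B Σ} → Σ ∋op n ⦂ A ⟶ B → Γ ⊢v v ⦂ A →
              (B ∷ Γ) ⨾ Z ⊢t T ⦂ Σ → Γ ⨾ Z ⊢t top n v T ⦂ Σ

lookupEnv : ∀ {Γ i A} → Γ ∋ i ⦂ A → ⟦ Γ ⟧ctx → ⟦ A ⟧v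
lookupEnv here      (η , a) = a
lookupEnv (there p) (η , _) = lookupEnv p η

lookupZ : ∀ {Z i B Y} → Z ∋ i ⦂ B → ⟦ Z ⟧Z Y → ⟦ B ⟧v → Y
lookupZ here      (ζ , g) = g
lookupZ (there p) (ζ , _) = lookupZ p ζ

opPos : ∀ {Σ n A B} → Σ ∋op n ⦂ A ⟶ B → Op Σ
opPos here      = zero
opPos (there p) = suc (opPos p)

argIn : ∀ {Σ n A B} (p : Σ ∋op n ⦂ A ⟶ B) → ⟦ A ⟧v → SArg Σ (opPos p)
argIn here      a = a
argIn (there p) a = argIn p a

resOut : ∀ {Σ n A B} (p : Σ ∋op n ⦂ A ⟶ B) → SRes Σ (opPos p) → ⟦ B ⟧v
resOut here      b = b
resOut (there p) b = resOut p b

module Semantics (L : Logic) where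
  open Typing L

  mutual
    ⟦_⟧ᵛ : ∀ {Γ v A} → Γ ⊢v v ⦂ A → ⟦ Γ ⟧ctx → ⟦ A ⟧v
    ⟦ ty-var p ⟧ᵛ η = lookupEnv p η
    ⟦ ty-unit ⟧ᵛ η  = tt
    ⟦ ty-true ⟧ᵛ η  = true
    ⟦ ty-false ⟧ᵛ η = false
    ⟦ ty-fun d ⟧ᵛ η = λ a → ⟦ d ⟧ᶜ (η , a)
    ⟦ ty-handler dr cls _ ⟧ᵛ η =
      lift (λ a → ⟦ dr ⟧ᶜ (η , a)) (⟦ cls ⟧ᶜˡ η)

    ⟦_⟧ᶜˡ : ∀ {Γ h Σ D} → Clauses Γ h Σ D → ⟦ Γ ⟧ctx → Interp Σ ⟦ D ⟧c
    ⟦ cls ⟧ᶜˡ η = interp (clauseSem cls η)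

    clauseSem : ∀ {Γ h Σ D} → Clauses Γ h Σ D → ⟦ Γ ⟧ctx →
                (o : Op Σ) → SArg Σ o → (SRes Σ o → ⟦ D ⟧c) → ⟦ D ⟧c
    clauseSem (cl-∷ _ d cls) η zero    a κ = ⟦ d ⟧ᶜ ((η , a) , κ)
    clauseSem (cl-∷ _ d cls) η (suc o) a κ = clauseSem cls η o a κ

    ⟦_⟧ᶜ : ∀ {Γ c C} → Γ ⊢c c ⦂ C → ⟦ Γ ⟧ctx → ⟦ C ⟧c
    ⟦ ty-if dv d₁ d₂ ⟧ᶜ η = if ⟦ dv ⟧ᵛ η then ⟦ d₁ ⟧ᶜ η else ⟦ d₂ ⟧ᶜ η
    ⟦ ty-app d₁ d₂ ⟧ᶜ η   = ⟦ d₁ ⟧ᵛ η (⟦ d₂ ⟧ᵛ η)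
    ⟦ ty-return dv ⟧ᶜ η   = in-ret (⟦ dv ⟧ᵛ η)
    ⟦ ty-op p dv d ⟧ᶜ η   =
      in-op (opPos p) (argIn p (⟦ dv ⟧ᵛ η)) (λ b → ⟦ d ⟧ᶜ (η , resOut p b))
    ⟦ ty-do {Σ = Σ} d₁ d₂ ⟧ᶜ η =
      lift (λ a → ⟦ d₂ ⟧ᶜ (η , a)) (freeInterp Σ _) (⟦ d₁ ⟧ᶜ η)
    ⟦ ty-with dv d ⟧ᶜ η   = ⟦ dv ⟧ᵛ η (⟦ d ⟧ᶜ η)

  ⟦_⟧ᵗ : ∀ {Γ Z T Σ} {Y : Set} → Γ ⨾ Z ⊢t T ⦂ Σ → Interp Σ Y →
         ⟦ Γ ⟧ctx → ⟦ Z ⟧Z Y → Y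
  ⟦ ty-tvar p dv ⟧ᵗ H η ζ = lookupZ p ζ (⟦ dv ⟧ᵛ η)
  ⟦ ty-tif dv d₁ d₂ ⟧ᵗ H η ζ =
    if ⟦ dv ⟧ᵛ η then ⟦ d₁ ⟧ᵗ H η ζ else ⟦ d₂ ⟧ᵗ H η ζ
  ⟦ ty-top p dv d ⟧ᵗ H η ζ =
    apply H (opPos p) (argIn p (⟦ dv ⟧ᵛ η)) (λ b → ⟦ d ⟧ᵗ H (η , resOut p b) ζ)

-- An interpretation homomorphism h (one commuting with the operations) carries
-- the template semantics over one interpretation to that over another, and
-- f†_H is a homomorphism out of the free interpretation.  Conversely, applied
-- to the one-operation template op(x; y. z y), the hypothesis of the second
-- part says exactly that φ is a homomorphism, and a homomorphism out of the
-- free interpretation is determined by its values on returns, so φ = g†_H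
-- with g x = φ (in_ret x).
module Submission where

open import Defs
open import Level using (0ℓ)
open import Axiom.Extensionality.Propositional using (Extensionality)
open import Relation.Binary.PropositionalEquality
  using (_≡_; refl; sym; trans; cong; cong₂; module ≡-Reasoning)
open import Data.Product using (_×_; _,_; Σ-syntax)
open import Data.Bool using (true; false)
open import Data.Unit using (tt)
open import Data.List using ([]; _∷_; map)
open import Data.List.Relation.Unary.Unique.Propositional using (Unique)
open import Data.Fin using (zero; suc)
open import Function using (_∘_)

IsHomomorphism : ∀ {Σ Y₁ Y₂} → Interp Σ Y₁ → Interp Σ Y₂ → (Y₁ → Y₂) → Set
IsHomomorphism {Σ} H₁ H₂ h =
  ∀ (o : Op Σ) a κ → h (apply H₁ o a κ) ≡ apply H₂ o a (h ∘ κ)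

lift-isHomomorphism : ∀ {Σ X Y} (f : X → Y) (H : Interp Σ Y) →
  IsHomomorphism (freeInterp Σ X) H (lift f H)
lift-isHomomorphism f H o a κ = refl

lookupZ-mapZ : ∀ {Y Y′ : Set} {Z i B} (p : Z ∋ i ⦂ B) (h : Y → Y′) (ζ : ⟦ Z ⟧Z Y) b →
  h (lookupZ p ζ b) ≡ lookupZ p (mapZ Z h ζ) b
lookupZ-mapZ here      h (ζ , g) b = refl
lookupZ-mapZ (there p) h (ζ , g) b = lookupZ-mapZ p h ζ b

data OpPosView (Σ : Sig) : Op Σ → Set where
  from-∋op : ∀ {n A B} (p : Σ ∋op n ⦂ A ⟶ B) → OpPosView Σ (opPos p)

opPos-view : (Σ : Sig) (o : Op Σ) → OpPosView Σ o
opPos-view (decl n A B ∷ Σ) zero = from-∋op here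
opPos-view (d ∷ Σ) (suc o) with opPos-view Σ o
... | from-∋op p = from-∋op (there p)

argOut : ∀ {Σ n A B} (p : Σ ∋op n ⦂ A ⟶ B) → SArg Σ (opPos p) → ⟦ A ⟧v
argOut here      a = a
argOut (there p) a = argOut p a

argIn∘argOut : ∀ {Σ n A B} (p : Σ ∋op n ⦂ A ⟶ B) a → argIn p (argOut p a) ≡ a
argIn∘argOut here      a = refl
argIn∘argOut (there p) a = argIn∘argOut p a

resIn : ∀ {Σ n A B} (p : Σ ∋op n ⦂ A ⟶ B) → ⟦ B ⟧v → SRes Σ (opPos p)
resIn here      b = b
resIn (there p) b = resIn p b

resIn∘resOut : ∀ {Σ n A B} (p : Σ ∋op n ⦂ A ⟶ B) b → resIn p (resOut p b) ≡ b
resIn∘resOut here      b = refl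
resIn∘resOut (there p) b = resIn∘resOut p b

module _ (ext : Extensionality 0ℓ 0ℓ) where

  homomorphism-unique : ∀ {Σ X Y} (H : Interp Σ Y) (φ : ⟦ Σ ⟧Σ X → Y) →
    IsHomomorphism (freeInterp Σ X) H φ → ∀ t → φ t ≡ lift (φ ∘ in-ret) H t
  homomorphism-unique H φ φ-hom (in-ret x)    = refl
  homomorphism-unique H φ φ-hom (in-op o a κ) =
    trans (φ-hom o a κ)
          (cong (apply H o a) (ext (homomorphism-unique H φ φ-hom ∘ κ)))

  module _ (L : Logic) where
    open Typing L
    open Semantics L

    ⟦⟧ᵗ-natural : ∀ {Σ Y₁ Y₂ Γ Z T} (H₁ : Interp Σ Y₁) (H₂ : Interp Σ Y₂) (h : Y₁ → Y₂) →
      IsHomomorphism H₁ H₂ h → (d : Γ ⨾ Z ⊢t T ⦂ Σ) (η : ⟦ Γ ⟧ctx) (ζ : ⟦ Z ⟧Z Y₁) →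
      h (⟦ d ⟧ᵗ H₁ η ζ) ≡ ⟦ d ⟧ᵗ H₂ η (mapZ Z h ζ)
    ⟦⟧ᵗ-natural H₁ H₂ h h-hom (ty-tvar p dv) η ζ = lookupZ-mapZ p h ζ (⟦ dv ⟧ᵛ η)
    ⟦⟧ᵗ-natural H₁ H₂ h h-hom (ty-tif dv d₁ d₂) η ζ with ⟦ dv ⟧ᵛ η
    ... | true  = ⟦⟧ᵗ-natural H₁ H₂ h h-hom d₁ η ζ
    ... | false = ⟦⟧ᵗ-natural H₁ H₂ h h-hom d₂ η ζ
    ⟦⟧ᵗ-natural H₁ H₂ h h-hom (ty-top p dv d) η ζ =
      trans (h-hom (opPos p) (argIn p (⟦ dv ⟧ᵛ η)) _)
            (cong (apply H₂ (opPos p) (argIn p (⟦ dv ⟧ᵛ η)))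
                  (ext (λ b → ⟦⟧ᵗ-natural H₁ H₂ h h-hom d (η , resOut p b) ζ)))

    PreservesTemplates : ∀ {Σ Y₁ Y₂} → Interp Σ Y₁ → Interp Σ Y₂ → (Y₁ → Y₂) → Set
    PreservesTemplates {Σ} {Y₁} H₁ H₂ h =
      ∀ (Γ : Ctx) (Z : TCtx) (T : Tmpl) (d : Γ ⨾ Z ⊢t T ⦂ Σ)
        (η : ⟦ Γ ⟧ctx) (ζ : ⟦ Z ⟧Z Y₁) →
        h (⟦ d ⟧ᵗ H₁ η ζ) ≡ ⟦ d ⟧ᵗ H₂ η (mapZ Z h ζ)

    preservesTemplates⇒isHomomorphism : ∀ {Σ Y₁ Y₂} (H₁ : Interp Σ Y₁) (H₂ : Interp Σ Y₂)
      (h : Y₁ → Y₂) → PreservesTemplates H₁ H₂ h → IsHomomorphism H₁ H₂ h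
    preservesTemplates⇒isHomomorphism {Σ} H₁ H₂ h preserves o a κ
      with opPos-view Σ o
    ... | from-∋op {n} {A} {B} p = begin
      h (apply H₁ o a κ)
        ≡⟨ cong₂ (λ a′ κ′ → h (apply H₁ o a′ κ′)) (sym (argIn∘argOut p a)) κ-roundtrip ⟩
      h (apply H₁ o (argIn p a′) (λ b → κ (resIn p (resOut p b))))
        ≡⟨ preserves (A ∷ []) (B ∷ []) (top n (var 0) (tvar 0 (var 0)))
             (ty-top p (ty-var here) (ty-tvar here (ty-var here)))
             (tt , a′) (tt , κ ∘ resIn p) ⟩
      apply H₂ o (argIn p a′) (λ b → h (κ (resIn p (resOut p b))))
        ≡⟨ cong₂ (λ a′ κ′ → apply H₂ o a′ (h ∘ κ′)) (argIn∘argOut p a) (sym κ-roundtrip) ⟩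
      apply H₂ o a (h ∘ κ) ∎
      where
      open ≡-Reasoning
      a′ = argOut p a
      κ-roundtrip : κ ≡ (λ b → κ (resIn p (resOut p b)))
      κ-roundtrip = ext (λ b → cong κ (sym (resIn∘resOut p b)))

-- The names of Σ need not be distinct: operations are addressed by their
-- positions in Σ.
lemma3 : Extensionality 0ℓ 0ℓ →
    (L : Logic) (Σ : Sig) → Unique (map declName Σ) →
    (X Y : Set) (H : Interp Σ Y) (f : X → Y) →
    (∀ (Γ : Ctx) (Z : TCtx) (T : Tmpl) (d : Typing._⨾_⊢t_⦂_ L Γ Z T Σ)
       (η : ⟦ Γ ⟧ctx) (ζ : ⟦ Z ⟧Z (⟦ Σ ⟧Σ X)) →
       lift f H (Semantics.⟦_⟧ᵗ L d (freeInterp Σ X) η ζ)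
         ≡ Semantics.⟦_⟧ᵗ L d H η (mapZ Z (lift f H) ζ))
    ×
    (∀ (φ : ⟦ Σ ⟧Σ X → Y) →
       (∀ (Γ : Ctx) (Z : TCtx) (T : Tmpl) (d : Typing._⨾_⊢t_⦂_ L Γ Z T Σ)
          (η : ⟦ Γ ⟧ctx) (ζ : ⟦ Z ⟧Z (⟦ Σ ⟧Σ X)) →
          φ (Semantics.⟦_⟧ᵗ L d (freeInterp Σ X) η ζ)
            ≡ Semantics.⟦_⟧ᵗ L d H η (mapZ Z φ ζ)) →
       Σ[ g ∈ (X → Y) ] (φ ≡ lift g H))
lemma3 ext L Σ _ X Y H f =
  (λ Γ Z T → ⟦⟧ᵗ-natural ext L (freeInterp Σ X) H (lift f H) (lift-isHomomorphism f H)) ,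
  λ φ preserves →
    φ ∘ in-ret ,
    ext (homomorphism-unique ext H φ
          (preservesTemplates⇒isHomomorphism ext L (freeInterp Σ X) H φ preserves))
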